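{- Let $b \in \mathcal{P}^d$ and $n \ge 1$. Then $n\Delta_d \cap (n\Delta_d - b) = \emptyset$ if and only if $\ell(b) > n$. If $\ell(b) \le n$, then \[ n\Delta_d \cap (n\Delta_d - b) \ = \ b^- + (n-\ell(b))\,\Delta_d \, . \] In particular, $E_b(\Delta_d;n) = \binom{n-\ell(b)+d}{d}$ for $\ell(b) \le n$ and $E_b(\Delta_d;n) = 0$ otherwise.
   Context: Let $\Delta_d \defeq \operatorname{conv}(e_1,\dots,e_{d+1}) = \{x \in \mathbb{R}^{d+1} : x \ge 0,\ x_1+\cdots+x_{d+1} = 1\}$ be the $d$-dimensional standard simplex, and for $n \ge 1$ let $n\Delta_d = \{np : p \in \Delta_d\}$. Define \[ \mathcal{P}^d \defeq \{ b \in \mathbb{Z}^{d+1} : \gcd(b_1,\dots,b_{d+1}) = 1,\ b_1+\cdots+b_{d+1} = 0\}. \] For $b \in \mathcal{P}^d$ there are unique $b^+, b^- \in \mathbb{Z}^{d+1}_{\ge 0}$ with $b = b^+ - b^-$ and $b^+_i b^-_i = 0$ for all $i$; set $\ell(b) \defeq \sum_i b^+_i = \sum_i b^-_i$. For a lattice polytope $P$ and a lattice vector $b$, $E_b(P;n) \defeq |\{ t \in \mathbb{Z}^{d+1} : t + [0,b] \subseteq nP\}| = |(nP) \cap (nP - b) \cap \mathbb{Z}^{d+1}|$, the number of lattice translates of the segment $[0,b]$ contained in $nP$.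
   Formalization: The simplex $\Delta_d$ and the sets $n\Delta_d$, $n\Delta_d - b$ and $b^- + (n-\ell(b))\,\Delta_d$ consist of points with rational coordinates, in ℚ^(d+1) instead of $\mathbb{R}^{d+1}$. -}

module Defs where

open import Data.Nat using (ℕ; suc)
open import Data.Nat.GCD using (gcd)
open import Data.Integer as ℤ using (ℤ; +_; ∣_∣; _⊔_; 0ℤ)
open import Data.Rational as ℚ using (ℚ; 0ℚ; 1ℚ)
open import Data.Vec using (Vec; map; zipWith; foldr)
open import Data.Vec.Relation.Unary.All using (All)
open import Data.List using (List; length)
open import Data.List.Membership.Propositional using (_∈_)
open import Data.List.Relation.Unary.Unique.Propositional using (Unique)
open import Data.Product using (Σ; _×_)
open import Relation.Binary.PropositionalEquality using (_≡_)
open import Relation.Nullary using (¬_)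
open import Function.Bundles using (_⇔_)

-- Points of ℝ^{d+1} are modelled by rational points (Vec ℚ (suc d)); sets by predicates.
Point : ℕ → Set
Point d = Vec ℚ (suc d)

Region : ℕ → Set₁
Region d = Point d → Set

ℤtoℚ : ℤ → ℚ
ℤtoℚ z = z ℚ./ 1

embed : ∀ {k} → Vec ℤ k → Vec ℚ k
embed = map ℤtoℚ

ℕtoℚ : ℕ → ℚ
ℕtoℚ n = ℤtoℚ (+ n)

sumℚ : ∀ {k} → Vec ℚ k → ℚ
sumℚ = foldr _ ℚ._+_ 0ℚ

sumℤ : ∀ {k} → Vec ℤ k → ℤ
sumℤ = foldr _ ℤ._+_ 0ℤ

Δ : (d : ℕ) → Region d
Δ d x = All (ℚ._≤_ 0ℚ) x × sumℚ x ≡ 1ℚ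

dilate : ∀ {d} → ℚ → Region d → Region d
dilate c P x = Σ (Point _) λ p → P p × x ≡ map (c ℚ.*_) p

translate : ∀ {d} → Point d → Region d → Region d
translate v P x = Σ (Point _) λ p → P p × x ≡ zipWith ℚ._+_ v p

_∩_ : ∀ {d} → Region d → Region d → Region d
(P ∩ Q) x = P x × Q x

IsEmpty : ∀ {d} → Region d → Set
IsEmpty P = ∀ x → ¬ P x

SameSet : ∀ {d} → Region d → Region d → Set
SameSet P Q = ∀ x → P x ⇔ Q x

gcdVec : ∀ {k} → Vec ℤ k → ℕ
gcdVec v = foldr _ gcd 0 (map ∣_∣ v)

InP : (d : ℕ) → Vec ℤ (suc d) → Set
InP d b = gcdVec b ≡ 1 × sumℤ b ≡ 0ℤ

bplus : ∀ {k} → Vec ℤ k → Vec ℤ k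
bplus = map (_⊔ 0ℤ)

bminus : ∀ {k} → Vec ℤ k → Vec ℤ k
bminus = map (λ z → (ℤ.- z) ⊔ 0ℤ)

-- ℓ(b) = Σ b⁺_i  (a nonnegative integer, returned as ℕ)
ℓ : ∀ {k} → Vec ℤ k → ℕ
ℓ b = ∣ sumℤ (bplus b) ∣

minusVec : ∀ {d} → Region d → Vec ℤ (suc d) → Region d
minusVec P b = translate (map ℚ.-_ (embed b)) P

HasCard : {A : Set} → (A → Set) → ℕ → Set
HasCard {A} P N = Σ (List A) λ L → Unique L × (∀ x → (x ∈ L) ⇔ P x) × length L ≡ N

-- E_b(Δ_d; n) = number of lattice points t ∈ ℤ^{d+1} in nΔ_d ∩ (nΔ_d − b);
-- stated as: this set of lattice points has exactly N elements
E-is : (d : ℕ) → Vec ℤ (suc d) → ℕ → ℕ → Set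
E-is d b n N = HasCard (λ (t : Vec ℤ (suc d)) →
  (dilate (ℕtoℚ n) (Δ d) ∩ minusVec (dilate (ℕtoℚ n) (Δ d)) b) (embed t)) N

-- Since Σ b = 0, a point x lies in nΔ ∩ (nΔ − b) iff x ≥ 0, x + b ≥ 0 and Σ x = n, i.e. iff
-- x ≥ b⁻ coordinatewise and Σ x = n.  As Σ b⁻ = ℓ(b), these are exactly the points b⁻ + y with
-- y ≥ 0 and Σ y = n − ℓ(b): the set b⁻ + (n − ℓ(b))Δ if ℓ(b) ≤ n, and nothing otherwise.  Its
-- lattice points are b⁻ + s for s ∈ ℕ^{d+1} with Σ s = n − ℓ(b), which Pascal's rule counts.
module Submission where

open import Defs

open import Algebra.Bundles using (AbelianGroup; CommutativeMonoid)
import Algebra.Properties.CommutativeSemigroup as CommutativeSemigroupProperties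
import Algebra.Properties.Group as GroupProperties
open import Data.Empty using (⊥-elim)
open import Data.Integer as ℤ using (ℤ; +_; -[1+_]; +[1+_]; 0ℤ)
import Data.Integer.Properties as ℤP
import Data.Integer.Solver as ℤSolver
open import Data.List as List using (List; _++_; length)
import Data.List.Properties as ListP
open import Data.List.Membership.Propositional using (_∈_)
open import Data.List.Membership.Propositional.Properties using (∈-map⁺; ∈-map⁻; ∈-++⁺ˡ; ∈-++⁺ʳ; ∈-++⁻)
open import Data.List.Relation.Binary.Disjoint.Propositional using (Disjoint)
open import Data.List.Relation.Unary.All using ([])
open import Data.List.Relation.Unary.AllPairs using ([]; _∷_)
open import Data.List.Relation.Unary.Any using (here)
open import Data.List.Relation.Unary.Unique.Propositional using (Unique)
import Data.List.Relation.Unary.Unique.Propositional.Properties as UniqueP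
open import Data.Nat using (ℕ; zero; suc; z≤n; _≤_; _<_; _∸_; _+_)
open import Data.Nat.Combinatorics using (_C_; nCn≡1; nCk+nC[k+1]≡[n+1]C[k+1])
import Data.Nat.Coprimality as Coprimality
import Data.Nat.Properties as ℕP
open import Data.Product using (∃; _×_; _,_; proj₁; map₂; zip′)
open import Data.Product.Function.NonDependent.Propositional using (_×-⇔_)
open import Data.Rational as ℚ using (ℚ; 0ℚ; 1ℚ; mkℚ)
import Data.Rational.Properties as ℚP
import Data.Rational.Solver as ℚSolver
open import Data.Sum using (inj₁; inj₂)
open import Data.Vec as Vec using (Vec; []; _∷_; zipWith; foldr; replicate; sum)
import Data.Vec.Properties as VecP
open import Data.Vec.Relation.Binary.Pointwise.Inductive as Pointwise using (Pointwise; []; _∷_)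
open import Data.Vec.Relation.Unary.All as All using (All; []; _∷_)
import Data.Vec.Relation.Unary.All.Properties as AllP
open import Function.Bundles using (_⇔_; mk⇔; Equivalence)
open import Function.Construct.Composition using (_⇔-∘_)
open import Function.Construct.Symmetry using (⇔-sym)
open import Relation.Binary.PropositionalEquality
  using (_≡_; refl; sym; trans; cong; cong₂; subst; subst₂; module ≡-Reasoning)
open import Relation.Nullary using (¬_)

open Equivalence using (to; from)

coprime-1 : ∀ n → Coprimality.Coprime n 1
coprime-1 n = Coprimality.sym (Coprimality.1-coprimeTo n)

ℤtoℚ≡mkℚ : ∀ z → ℤtoℚ z ≡ mkℚ z 0 (coprime-1 ℤ.∣ z ∣)
ℤtoℚ≡mkℚ (+ n)    = ℚP.normalize-coprime (coprime-1 n)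
ℤtoℚ≡mkℚ -[1+ n ] = cong ℚ.-_ (ℚP.normalize-coprime (coprime-1 (suc n)))

ℤtoℚ-+ : ∀ i j → ℤtoℚ (i ℤ.+ j) ≡ ℤtoℚ i ℚ.+ ℤtoℚ j
ℤtoℚ-+ i j = sym (trans (cong₂ ℚ._+_ (ℤtoℚ≡mkℚ i) (ℤtoℚ≡mkℚ j))
  (cong ℤtoℚ (cong₂ ℤ._+_ (ℤP.*-identityʳ i) (ℤP.*-identityʳ j))))

ℤtoℚ-mono-≤ : ∀ {i j} → i ℤ.≤ j → ℤtoℚ i ℚ.≤ ℤtoℚ j
ℤtoℚ-mono-≤ {i} {j} i≤j = subst₂ ℚ._≤_ (sym (ℤtoℚ≡mkℚ i)) (sym (ℤtoℚ≡mkℚ j))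
  (ℚ.*≤* (subst₂ ℤ._≤_ (sym (ℤP.*-identityʳ i)) (sym (ℤP.*-identityʳ j)) i≤j))

ℤtoℚ-cancel-≤ : ∀ {i j} → ℤtoℚ i ℚ.≤ ℤtoℚ j → i ℤ.≤ j
ℤtoℚ-cancel-≤ {i} {j} i≤j = subst₂ ℤ._≤_ (ℤP.*-identityʳ i) (ℤP.*-identityʳ j)
  (ℚP.drop-*≤* (subst₂ ℚ._≤_ (ℤtoℚ≡mkℚ i) (ℤtoℚ≡mkℚ j) i≤j))

ℤtoℚ-injective : ∀ {i j} → ℤtoℚ i ≡ ℤtoℚ j → i ≡ j
ℤtoℚ-injective i≡j = ℤP.≤-antisym (ℤtoℚ-cancel-≤ (ℚP.≤-reflexive i≡j))
                                  (ℤtoℚ-cancel-≤ (ℚP.≤-reflexive (sym i≡j)))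

0≤ℕtoℚ : ∀ n → 0ℚ ℚ.≤ ℕtoℚ n
0≤ℕtoℚ n = ℤtoℚ-mono-≤ {0ℤ} {+ n} (ℤ.+≤+ z≤n)

module _ {c ℓ} (M : CommutativeMonoid c ℓ) where
  open CommutativeMonoid M using (Carrier; _≈_; _∙_; ε; ∙-congˡ; identityˡ; commutativeSemigroup; setoid)
    renaming (sym to ≈-sym)
  open CommutativeSemigroupProperties commutativeSemigroup using (interchange)
  open import Relation.Binary.Reasoning.Setoid setoid

  foldr-zipWith : ∀ {k} (u v : Vec Carrier k) →
                  foldr _ _∙_ ε (zipWith _∙_ u v) ≈ foldr _ _∙_ ε u ∙ foldr _ _∙_ ε v
  foldr-zipWith []      []      = ≈-sym (identityˡ ε)
  foldr-zipWith (x ∷ u) (y ∷ v) = begin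
    (x ∙ y) ∙ foldr _ _∙_ ε (zipWith _∙_ u v)       ≈⟨ ∙-congˡ (foldr-zipWith u v) ⟩
    (x ∙ y) ∙ (foldr _ _∙_ ε u ∙ foldr _ _∙_ ε v)   ≈⟨ interchange x y _ _ ⟩
    (x ∙ foldr _ _∙_ ε u) ∙ (y ∙ foldr _ _∙_ ε v)   ∎

sumℚ-zipWith : ∀ {k} (u v : Vec ℚ k) → sumℚ (zipWith ℚ._+_ u v) ≡ sumℚ u ℚ.+ sumℚ v
sumℚ-zipWith = foldr-zipWith ℚP.+-0-commutativeMonoid

sumℤ-zipWith : ∀ {k} (u v : Vec ℤ k) → sumℤ (zipWith ℤ._+_ u v) ≡ sumℤ u ℤ.+ sumℤ v
sumℤ-zipWith = foldr-zipWith ℤP.+-0-commutativeMonoid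

sumℚ-embed : ∀ {k} (v : Vec ℤ k) → sumℚ (embed v) ≡ ℤtoℚ (sumℤ v)
sumℚ-embed []      = refl
sumℚ-embed (z ∷ v) = trans (cong (ℤtoℚ z ℚ.+_) (sumℚ-embed v)) (sym (ℤtoℚ-+ z (sumℤ v)))

sumℚ-map-* : ∀ {k} c (p : Vec ℚ k) → sumℚ (Vec.map (c ℚ.*_) p) ≡ c ℚ.* sumℚ p
sumℚ-map-* c []      = sym (ℚP.*-zeroʳ c)
sumℚ-map-* c (x ∷ p) = trans (cong (c ℚ.* x ℚ.+_) (sumℚ-map-* c p)) (sym (ℚP.*-distribˡ-+ c x (sumℚ p)))

sumℚ-mono-≤ : ∀ {k} {u v : Vec ℚ k} → Pointwise ℚ._≤_ u v → sumℚ u ℚ.≤ sumℚ v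
sumℚ-mono-≤ []           = ℚP.≤-refl
sumℚ-mono-≤ (x≤y ∷ u≤v) = ℚP.+-mono-≤ x≤y (sumℚ-mono-≤ u≤v)

sumℚ-replicate-0 : ∀ k → sumℚ (replicate k 0ℚ) ≡ 0ℚ
sumℚ-replicate-0 zero    = refl
sumℚ-replicate-0 (suc k) = trans (ℚP.+-identityˡ _) (sumℚ-replicate-0 k)

ℚ+-cancelˡ-≡ : ∀ p {q r} → p ℚ.+ q ≡ p ℚ.+ r → q ≡ r
ℚ+-cancelˡ-≡ p = GroupProperties.∙-cancelˡ ℚP.+-0-group p _ _

ℤ+-cancelˡ-≡ : ∀ i {j k} → i ℤ.+ j ≡ i ℤ.+ k → j ≡ k
ℤ+-cancelˡ-≡ i = GroupProperties.∙-cancelˡ (AbelianGroup.group ℤP.+-0-abelianGroup) i _ _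

module _ where
  open ℚSolver.+-*-Solver

  [q-p]+p≡q : ∀ p q → (q ℚ.- p) ℚ.+ p ≡ q
  [q-p]+p≡q = solve 2 (λ p q → (q :- p) :+ p := q) refl

  p+[q-p]≡q : ∀ p q → p ℚ.+ (q ℚ.- p) ≡ q
  p+[q-p]≡q = solve 2 (λ p q → p :+ (q :- p) := q) refl

  [-p+q]+p≡q : ∀ p q → (ℚ.- p ℚ.+ q) ℚ.+ p ≡ q
  [-p+q]+p≡q = solve 2 (λ p q → (:- p :+ q) :+ p := q) refl

  -p+[q+p]≡q : ∀ p q → ℚ.- p ℚ.+ (q ℚ.+ p) ≡ q
  -p+[q+p]≡q = solve 2 (λ p q → :- p :+ (q :+ p) := q) refl

p≤p+q : ∀ p {q} → 0ℚ ℚ.≤ q → p ℚ.≤ p ℚ.+ q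
p≤p+q p {q} 0≤q = subst (ℚ._≤ p ℚ.+ q) (ℚP.+-identityʳ p) (ℚP.+-monoʳ-≤ p 0≤q)

≤⇔0≤- : ∀ {p q} → p ℚ.≤ q ⇔ 0ℚ ℚ.≤ q ℚ.- p
≤⇔0≤- {p} {q} = mk⇔
  (λ p≤q → subst (ℚ._≤ q ℚ.- p) (ℚP.+-inverseʳ p) (ℚP.+-monoˡ-≤ (ℚ.- p) p≤q))
  (λ 0≤q-p → subst₂ ℚ._≤_ (ℚP.+-identityˡ p) ([q-p]+p≡q p q) (ℚP.+-monoˡ-≤ p 0≤q-p))

0≤p*q : ∀ {p q} → 0ℚ ℚ.≤ p → 0ℚ ℚ.≤ q → 0ℚ ℚ.≤ p ℚ.* q
0≤p*q {p} {q} 0≤p 0≤q =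
  subst (ℚ._≤ p ℚ.* q) (ℚP.*-zeroʳ p) (ℚP.*-monoˡ-≤-nonNeg p {{ℚ.nonNegative 0≤p}} 0≤q)

0≤sumℚ : ∀ {k} {x : Vec ℚ k} → All (0ℚ ℚ.≤_) x → 0ℚ ℚ.≤ sumℚ x
0≤sumℚ []                       = ℚP.≤-refl
0≤sumℚ {x = a ∷ x} (0≤a ∷ 0≤x) =
  subst (ℚ._≤ a ℚ.+ sumℚ x) (ℚP.+-identityʳ 0ℚ) (ℚP.+-mono-≤ 0≤a (0≤sumℚ 0≤x))

nonNeg∧sumℚ≡0⇒≡0 : ∀ {k} {x : Vec ℚ k} → All (0ℚ ℚ.≤_) x → sumℚ x ≡ 0ℚ → x ≡ replicate k 0ℚ
nonNeg∧sumℚ≡0⇒≡0 []                    _      = refl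
nonNeg∧sumℚ≡0⇒≡0 {x = a ∷ x} (0≤a ∷ 0≤x) a+Σx≡0 =
  cong₂ _∷_ a≡0 (nonNeg∧sumℚ≡0⇒≡0 0≤x
    (trans (sym (ℚP.+-identityˡ (sumℚ x))) (subst (λ c → c ℚ.+ sumℚ x ≡ 0ℚ) a≡0 a+Σx≡0)))
  where
  a≡0 : a ≡ 0ℚ
  a≡0 = ℚP.≤-antisym (subst (a ℚ.≤_) a+Σx≡0 (p≤p+q a (0≤sumℚ 0≤x))) 0≤a

All-replicate : ∀ {A : Set} {P : A → Set} {a} k → P a → All P (replicate k a)
All-replicate zero    _  = []
All-replicate (suc k) Pa = Pa ∷ All-replicate k Pa

e₁ : ∀ d → Point d
e₁ d = 1ℚ ∷ replicate d 0ℚ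

e₁∈Δ : ∀ d → Δ d (e₁ d)
e₁∈Δ d = (ℚ.*≤* (ℤ.+≤+ z≤n) ∷ All-replicate d ℚP.≤-refl) ,
         trans (cong (1ℚ ℚ.+_) (sumℚ-replicate-0 d)) (ℚP.+-identityʳ 1ℚ)

dilate-Δ⇔ : ∀ {d} m (x : Point d) → dilate (ℕtoℚ m) (Δ d) x ⇔ (All (0ℚ ℚ.≤_) x × sumℚ x ≡ ℕtoℚ m)
dilate-Δ⇔ {d} m x = mk⇔ dilated (undilate m)
  where
  dilated : dilate (ℕtoℚ m) (Δ d) x → All (0ℚ ℚ.≤_) x × sumℚ x ≡ ℕtoℚ m
  dilated (p , (0≤p , Σp≡1) , refl) =
    AllP.map⁺ (All.map (0≤p*q (0≤ℕtoℚ m)) 0≤p) ,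
    trans (sumℚ-map-* (ℕtoℚ m) p) (trans (cong (ℕtoℚ m ℚ.*_) Σp≡1) (ℚP.*-identityʳ (ℕtoℚ m)))
  undilate : ∀ m → All (0ℚ ℚ.≤_) x × sumℚ x ≡ ℕtoℚ m → dilate (ℕtoℚ m) (Δ d) x
  undilate zero (0≤x , Σx≡0) = e₁ d , e₁∈Δ d , (begin
    x                           ≡⟨ nonNeg∧sumℚ≡0⇒≡0 0≤x Σx≡0 ⟩
    replicate (suc d) 0ℚ        ≡⟨ VecP.map-const (e₁ d) 0ℚ ⟨
    Vec.map (λ _ → 0ℚ) (e₁ d)   ≡⟨ VecP.map-cong (λ a → sym (ℚP.*-zeroˡ a)) (e₁ d) ⟩
    Vec.map (0ℚ ℚ.*_) (e₁ d)    ∎)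
    where open ≡-Reasoning
  undilate (suc m) (0≤x , Σx≡m) = Vec.map (c⁻¹ ℚ.*_) x , (0≤c⁻¹x , Σc⁻¹x≡1) , x≡c[c⁻¹x]
    where
    open ≡-Reasoning
    c c⁻¹ : ℚ
    c = mkℚ (+ suc m) 0 (coprime-1 (suc m))
    c⁻¹ = ℚ.1/ c
    c≡m : ℕtoℚ (suc m) ≡ c
    c≡m = ℤtoℚ≡mkℚ (+ suc m)
    0≤c⁻¹x : All (0ℚ ℚ.≤_) (Vec.map (c⁻¹ ℚ.*_) x)
    0≤c⁻¹x = AllP.map⁺ (All.map (0≤p*q {c⁻¹} (ℚ.*≤* (ℤ.+≤+ z≤n))) 0≤x)
    Σc⁻¹x≡1 : sumℚ (Vec.map (c⁻¹ ℚ.*_) x) ≡ 1ℚ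
    Σc⁻¹x≡1 = begin
      sumℚ (Vec.map (c⁻¹ ℚ.*_) x)  ≡⟨ sumℚ-map-* c⁻¹ x ⟩
      c⁻¹ ℚ.* sumℚ x               ≡⟨ cong (c⁻¹ ℚ.*_) (trans Σx≡m c≡m) ⟩
      c⁻¹ ℚ.* c                    ≡⟨ ℚP.*-inverseˡ c ⟩
      1ℚ                           ∎
    c[c⁻¹a]≡a : ∀ a → ℕtoℚ (suc m) ℚ.* (c⁻¹ ℚ.* a) ≡ a
    c[c⁻¹a]≡a a = begin
      ℕtoℚ (suc m) ℚ.* (c⁻¹ ℚ.* a)  ≡⟨ cong (ℚ._* (c⁻¹ ℚ.* a)) c≡m ⟩
      c ℚ.* (c⁻¹ ℚ.* a)             ≡⟨ ℚP.*-assoc c c⁻¹ a ⟨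
      (c ℚ.* c⁻¹) ℚ.* a             ≡⟨ cong (ℚ._* a) (ℚP.*-inverseʳ c) ⟩
      1ℚ ℚ.* a                      ≡⟨ ℚP.*-identityˡ a ⟩
      a                             ∎
    x≡c[c⁻¹x] : x ≡ Vec.map (ℕtoℚ (suc m) ℚ.*_) (Vec.map (c⁻¹ ℚ.*_) x)
    x≡c[c⁻¹x] = begin
      x                                                         ≡⟨ VecP.map-id x ⟨
      Vec.map (λ a → a) x                                       ≡⟨ VecP.map-cong (λ a → sym (c[c⁻¹a]≡a a)) x ⟩
      Vec.map (λ a → ℕtoℚ (suc m) ℚ.* (c⁻¹ ℚ.* a)) x            ≡⟨ VecP.map-∘ _ _ x ⟩
      Vec.map (ℕtoℚ (suc m) ℚ.*_) (Vec.map (c⁻¹ ℚ.*_) x)        ∎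

translate-neg⇔ : ∀ {d} (P : Region d) (v : Point d) x →
                 translate (Vec.map ℚ.-_ v) P x ⇔ P (zipWith ℚ._+_ x v)
translate-neg⇔ P v x = mk⇔
  (λ { (p , Pp , refl) → subst P (sym ([-v+p]+v≡p v p)) Pp })
  (λ P[x+v] → zipWith ℚ._+_ x v , P[x+v] , sym (-v+[x+v]≡x v x))
  where
  [-v+p]+v≡p : ∀ {k} (v p : Vec ℚ k) → zipWith ℚ._+_ (zipWith ℚ._+_ (Vec.map ℚ.-_ v) p) v ≡ p
  [-v+p]+v≡p []      []      = refl
  [-v+p]+v≡p (a ∷ v) (b ∷ p) = cong₂ _∷_ ([-p+q]+p≡q a b) ([-v+p]+v≡p v p)
  -v+[x+v]≡x : ∀ {k} (v x : Vec ℚ k) → zipWith ℚ._+_ (Vec.map ℚ.-_ v) (zipWith ℚ._+_ x v) ≡ x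
  -v+[x+v]≡x []      []      = refl
  -v+[x+v]≡x (a ∷ v) (b ∷ x) = cong₂ _∷_ (-p+[q+p]≡q a b) (-v+[x+v]≡x v x)

translate-dilate-Δ⇔ : ∀ {d} (w : Point d) m x →
  translate w (dilate (ℕtoℚ m) (Δ d)) x ⇔ (Pointwise ℚ._≤_ w x × sumℚ x ≡ sumℚ w ℚ.+ ℕtoℚ m)
translate-dilate-Δ⇔ {d} w m x = mk⇔ bounds translated
  where
  w≤w+y : ∀ {k} (w : Vec ℚ k) {y} → All (0ℚ ℚ.≤_) y → Pointwise ℚ._≤_ w (zipWith ℚ._+_ w y)
  w≤w+y []      []          = []
  w≤w+y (a ∷ w) (0≤b ∷ 0≤y) = p≤p+q a 0≤b ∷ w≤w+y w 0≤y
  0≤x-w : ∀ {k} {w x : Vec ℚ k} → Pointwise ℚ._≤_ w x → All (0ℚ ℚ.≤_) (zipWith ℚ._-_ x w)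
  0≤x-w []          = []
  0≤x-w (a≤b ∷ w≤x) = to ≤⇔0≤- a≤b ∷ 0≤x-w w≤x
  w+[x-w]≡x : ∀ {k} (w x : Vec ℚ k) → zipWith ℚ._+_ w (zipWith ℚ._-_ x w) ≡ x
  w+[x-w]≡x []      []      = refl
  w+[x-w]≡x (a ∷ w) (b ∷ x) = cong₂ _∷_ (p+[q-p]≡q a b) (w+[x-w]≡x w x)

  bounds : translate w (dilate (ℕtoℚ m) (Δ d)) x → Pointwise ℚ._≤_ w x × sumℚ x ≡ sumℚ w ℚ.+ ℕtoℚ m
  bounds (y , y∈mΔ , refl) with to (dilate-Δ⇔ m y) y∈mΔ
  ... | 0≤y , Σy≡m = w≤w+y w 0≤y , trans (sumℚ-zipWith w y) (cong (sumℚ w ℚ.+_) Σy≡m)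
  translated : Pointwise ℚ._≤_ w x × sumℚ x ≡ sumℚ w ℚ.+ ℕtoℚ m → translate w (dilate (ℕtoℚ m) (Δ d)) x
  translated (w≤x , Σx≡Σw+m) = y , from (dilate-Δ⇔ m y) (0≤x-w w≤x , Σy≡m) , sym (w+[x-w]≡x w x)
    where
    y : Point d
    y = zipWith ℚ._-_ x w
    Σy≡m : sumℚ y ≡ ℕtoℚ m
    Σy≡m = ℚ+-cancelˡ-≡ (sumℚ w)
      (trans (sym (sumℚ-zipWith w y)) (trans (cong sumℚ (w+[x-w]≡x w x)) Σx≡Σw+m))

0≤x∧0≤x+z⇔z⁻≤x : ∀ x z → (0ℚ ℚ.≤ x × 0ℚ ℚ.≤ x ℚ.+ ℤtoℚ z) ⇔ ℤtoℚ ((ℤ.- z) ℤ.⊔ 0ℤ) ℚ.≤ x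
0≤x∧0≤x+z⇔z⁻≤x x (+ zero)   = mk⇔ proj₁ (λ 0≤x → 0≤x , subst (0ℚ ℚ.≤_) (sym (ℚP.+-identityʳ x)) 0≤x)
0≤x∧0≤x+z⇔z⁻≤x x +[1+ k ]   = mk⇔ proj₁ (λ 0≤x → 0≤x , ℚP.≤-trans 0≤x (p≤p+q x (0≤ℕtoℚ (suc k))))
0≤x∧0≤x+z⇔z⁻≤x x -[1+ k ]   = mk⇔ (λ (_ , 0≤x-k) → from ≤⇔0≤- 0≤x-k)
                                   (λ k≤x → ℚP.≤-trans (0≤ℕtoℚ (suc k)) k≤x , to ≤⇔0≤- k≤x)

0≤x∧0≤x+b⇔b⁻≤x : ∀ {k} (x : Vec ℚ k) (b : Vec ℤ k) →
  (All (0ℚ ℚ.≤_) x × All (0ℚ ℚ.≤_) (zipWith ℚ._+_ x (embed b))) ⇔ Pointwise ℚ._≤_ (embed (bminus b)) x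
0≤x∧0≤x+b⇔b⁻≤x []      []      = mk⇔ (λ _ → []) (λ _ → [] , [])
0≤x∧0≤x+b⇔b⁻≤x (a ∷ x) (z ∷ b) = mk⇔
  (λ { (0≤a ∷ 0≤x , 0≤a+z ∷ 0≤x+b) →
         to (0≤x∧0≤x+z⇔z⁻≤x a z) (0≤a , 0≤a+z) ∷ to (0≤x∧0≤x+b⇔b⁻≤x x b) (0≤x , 0≤x+b) })
  (λ { (z⁻≤a ∷ b⁻≤x) →
         zip′ _∷_ _∷_ (from (0≤x∧0≤x+z⇔z⁻≤x a z) z⁻≤a) (from (0≤x∧0≤x+b⇔b⁻≤x x b) b⁻≤x) })

bplus≡b+bminus : ∀ {k} (b : Vec ℤ k) → bplus b ≡ zipWith ℤ._+_ b (bminus b)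
bplus≡b+bminus []      = refl
bplus≡b+bminus (z ∷ b) = cong₂ _∷_ (z⁺≡z+z⁻ z) (bplus≡b+bminus b)
  where
  z⁺≡z+z⁻ : ∀ z → z ℤ.⊔ 0ℤ ≡ z ℤ.+ ((ℤ.- z) ℤ.⊔ 0ℤ)
  z⁺≡z+z⁻ (+ zero)  = refl
  z⁺≡z+z⁻ +[1+ k ]  = sym (ℤP.+-identityʳ +[1+ k ])
  z⁺≡z+z⁻ -[1+ k ]  = sym (ℤP.+-inverseˡ +[1+ k ])

0≤sumℤ-bplus : ∀ {k} (b : Vec ℤ k) → 0ℤ ℤ.≤ sumℤ (bplus b)
0≤sumℤ-bplus []      = ℤP.≤-refl
0≤sumℤ-bplus (z ∷ b) = ℤP.+-mono-≤ {0ℤ} {z ℤ.⊔ 0ℤ} {0ℤ} (ℤP.i≤j⊔i z 0ℤ) (0≤sumℤ-bplus b)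

sumℤ-bminus≡ℓ : ∀ {k} (b : Vec ℤ k) → sumℤ b ≡ 0ℤ → sumℤ (bminus b) ≡ + ℓ b
sumℤ-bminus≡ℓ b Σb≡0 = begin
  sumℤ (bminus b)                ≡⟨ ℤP.+-identityˡ _ ⟨
  0ℤ ℤ.+ sumℤ (bminus b)         ≡⟨ cong (ℤ._+ sumℤ (bminus b)) Σb≡0 ⟨
  sumℤ b ℤ.+ sumℤ (bminus b)     ≡⟨ sumℤ-zipWith b (bminus b) ⟨
  sumℤ (zipWith ℤ._+_ b (bminus b)) ≡⟨ cong sumℤ (bplus≡b+bminus b) ⟨
  sumℤ (bplus b)                 ≡⟨ ℤP.0≤i⇒+∣i∣≡i (0≤sumℤ-bplus b) ⟨
  + ℓ b                          ∎
  where open ≡-Reasoning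

sumℚ-bminus≡ℓ : ∀ {k} (b : Vec ℤ k) → sumℤ b ≡ 0ℤ → sumℚ (embed (bminus b)) ≡ ℕtoℚ (ℓ b)
sumℚ-bminus≡ℓ b Σb≡0 = trans (sumℚ-embed (bminus b)) (cong ℤtoℚ (sumℤ-bminus≡ℓ b Σb≡0))

Δ-overlap : (d : ℕ) → Vec ℤ (suc d) → ℕ → Region d
Δ-overlap d b n = dilate (ℕtoℚ n) (Δ d) ∩ minusVec (dilate (ℕtoℚ n) (Δ d)) b

Δ-overlap⇔ : ∀ {d b} n → sumℤ b ≡ 0ℤ → ∀ x →
  Δ-overlap d b n x ⇔ (Pointwise ℚ._≤_ (embed (bminus b)) x × sumℚ x ≡ ℕtoℚ n)
Δ-overlap⇔ {d} {b} n Σb≡0 x = mk⇔ bounds inOverlap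
  where
  x+b : Point d
  x+b = zipWith ℚ._+_ x (embed b)
  Σ[x+b]≡Σx : sumℚ x+b ≡ sumℚ x
  Σ[x+b]≡Σx = trans (sumℚ-zipWith x (embed b))
    (trans (cong (sumℚ x ℚ.+_) (trans (sumℚ-embed b) (cong ℤtoℚ Σb≡0))) (ℚP.+-identityʳ (sumℚ x)))
  bounds : Δ-overlap d b n x → Pointwise ℚ._≤_ (embed (bminus b)) x × sumℚ x ≡ ℕtoℚ n
  bounds (x∈nΔ , x∈nΔ-b) with to (dilate-Δ⇔ n x) x∈nΔ
                            | to (dilate-Δ⇔ n x+b) (to (translate-neg⇔ _ (embed b) x) x∈nΔ-b)
  ... | 0≤x , Σx≡n | 0≤x+b , _ = to (0≤x∧0≤x+b⇔b⁻≤x x b) (0≤x , 0≤x+b) , Σx≡n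
  inOverlap : Pointwise ℚ._≤_ (embed (bminus b)) x × sumℚ x ≡ ℕtoℚ n → Δ-overlap d b n x
  inOverlap (b⁻≤x , Σx≡n) with from (0≤x∧0≤x+b⇔b⁻≤x x b) b⁻≤x
  ... | 0≤x , 0≤x+b = from (dilate-Δ⇔ n x) (0≤x , Σx≡n) ,
                      from (translate-neg⇔ _ (embed b) x) (from (dilate-Δ⇔ n x+b) (0≤x+b , trans Σ[x+b]≡Σx Σx≡n))

Δ-overlap≃translate : ∀ {d b n} → sumℤ b ≡ 0ℤ → ℓ b ≤ n →
  SameSet (Δ-overlap d b n) (translate (embed (bminus b)) (dilate (ℕtoℚ (n ∸ ℓ b)) (Δ d)))
Δ-overlap≃translate {d} {b} {n} Σb≡0 ℓ≤n x =
  ⇔-sym (translate-dilate-Δ⇔ (embed (bminus b)) (n ∸ ℓ b) x) ⇔-∘ (sum-target⇔ ⇔-∘ Δ-overlap⇔ n Σb≡0 x)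
  where
  n≡Σb⁻+[n∸ℓ] : ℕtoℚ n ≡ sumℚ (embed (bminus b)) ℚ.+ ℕtoℚ (n ∸ ℓ b)
  n≡Σb⁻+[n∸ℓ] = trans (cong ℕtoℚ (sym (ℕP.m+[n∸m]≡n ℓ≤n)))
    (trans (ℤtoℚ-+ (+ ℓ b) (+ (n ∸ ℓ b))) (cong (ℚ._+ ℕtoℚ (n ∸ ℓ b)) (sym (sumℚ-bminus≡ℓ b Σb≡0))))
  sum-target⇔ : ∀ {A : Set} → (A × sumℚ x ≡ ℕtoℚ n) ⇔ (A × sumℚ x ≡ sumℚ (embed (bminus b)) ℚ.+ ℕtoℚ (n ∸ ℓ b))
  sum-target⇔ = mk⇔ (map₂ (λ Σx≡n → trans Σx≡n n≡Σb⁻+[n∸ℓ])) (map₂ (λ Σx≡… → trans Σx≡… (sym n≡Σb⁻+[n∸ℓ])))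

Δ-overlap-empty⇔ : ∀ {d b} n → sumℤ b ≡ 0ℤ → IsEmpty (Δ-overlap d b n) ⇔ n < ℓ b
Δ-overlap-empty⇔ {d} {b} n Σb≡0 = mk⇔ IsEmpty⇒n<ℓ n<ℓ⇒IsEmpty
  where
  IsEmpty⇒n<ℓ : IsEmpty (Δ-overlap d b n) → n < ℓ b
  IsEmpty⇒n<ℓ ∅ = ℕP.≰⇒> (λ ℓ≤n → ∅ _ (from (Δ-overlap≃translate Σb≡0 ℓ≤n _) (_ , (e₁ d , e₁∈Δ d , refl) , refl)))
  n<ℓ⇒IsEmpty : n < ℓ b → IsEmpty (Δ-overlap d b n)
  n<ℓ⇒IsEmpty n<ℓ x x∈ with to (Δ-overlap⇔ n Σb≡0 x) x∈
  ... | b⁻≤x , Σx≡n = ℕP.<⇒≱ n<ℓ (ℤP.drop‿+≤+ (ℤtoℚ-cancel-≤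
          (subst₂ ℚ._≤_ (sumℚ-bminus≡ℓ b Σb≡0) Σx≡n (sumℚ-mono-≤ b⁻≤x))))

HasCard-cong : ∀ {A : Set} {P Q : A → Set} {N} → (∀ x → P x ⇔ Q x) → HasCard P N → HasCard Q N
HasCard-cong P⇔Q (xs , xs-unique , ∈xs⇔P , |xs|≡N) = xs , xs-unique , (λ x → P⇔Q x ⇔-∘ ∈xs⇔P x) , |xs|≡N

HasCard-none : ∀ {A : Set} {P : A → Set} → (∀ x → ¬ P x) → HasCard P 0
HasCard-none ¬P = List.[] , [] , (λ x → mk⇔ (λ ()) (λ Px → ⊥-elim (¬P x Px))) , refl

HasCard-image : ∀ {A B : Set} {P : A → Set} {N} {f : A → B} → (∀ {x y} → f x ≡ f y → x ≡ y) →
                HasCard P N → HasCard (λ y → ∃ λ x → P x × y ≡ f x) N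
HasCard-image {P = P} {f = f} f-injective (xs , xs-unique , ∈xs⇔P , |xs|≡N) =
  List.map f xs , UniqueP.map⁺ f-injective xs-unique , ∈image⇔ , trans (ListP.length-map f xs) |xs|≡N
  where
  ∈image⇔ : ∀ y → y ∈ List.map f xs ⇔ (∃ λ x → P x × y ≡ f x)
  ∈image⇔ y = mk⇔
    (λ y∈ → let x , x∈xs , y≡fx = ∈-map⁻ f y∈ in x , to (∈xs⇔P x) x∈xs , y≡fx)
    (λ { (x , Px , refl) → ∈-map⁺ f (from (∈xs⇔P x) Px) })

suc-head : ∀ {k} → Vec ℕ (suc k) → Vec ℕ (suc k)
suc-head (h ∷ s) = suc h ∷ s

-- Split by whether the first part is 0; this realises Pascal's rule for (m + k) C k.
compositions : (k m : ℕ) → List (Vec ℕ (suc k))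
compositions zero    m       = List.[ m ∷ [] ]
compositions (suc k) zero    = List.map (0 ∷_) (compositions k zero)
compositions (suc k) (suc m) = List.map (0 ∷_) (compositions k (suc m)) ++ List.map suc-head (compositions (suc k) m)

∈-compositions⁻ : ∀ k m {s} → s ∈ compositions k m → sum s ≡ m
∈-compositions⁻ zero    m       (here refl) = ℕP.+-identityʳ m
∈-compositions⁻ (suc k) zero    s∈ with ∈-map⁻ (0 ∷_) s∈
... | _ , r∈ , refl = ∈-compositions⁻ k zero r∈
∈-compositions⁻ (suc k) (suc m) s∈ with ∈-++⁻ (List.map (0 ∷_) (compositions k (suc m))) s∈
... | inj₁ s∈₁ with ∈-map⁻ (0 ∷_) s∈₁
...   | _ , r∈ , refl = ∈-compositions⁻ k (suc m) r∈
∈-compositions⁻ (suc k) (suc m) s∈ | inj₂ s∈₂ with ∈-map⁻ suc-head s∈₂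
...   | _ ∷ _ , r∈ , refl = cong suc (∈-compositions⁻ (suc k) m r∈)

∈-compositions⁺ : ∀ k m (s : Vec ℕ (suc k)) → sum s ≡ m → s ∈ compositions k m
∈-compositions⁺ zero    m       (h ∷ [])     Σs≡m = here (cong (_∷ []) (trans (sym (ℕP.+-identityʳ h)) Σs≡m))
∈-compositions⁺ (suc k) zero    (zero ∷ s)   Σs≡m = ∈-map⁺ (0 ∷_) (∈-compositions⁺ k zero s Σs≡m)
∈-compositions⁺ (suc k) (suc m) (zero ∷ s)   Σs≡m = ∈-++⁺ˡ (∈-map⁺ (0 ∷_) (∈-compositions⁺ k (suc m) s Σs≡m))
∈-compositions⁺ (suc k) (suc m) (suc h ∷ s)  Σs≡m = ∈-++⁺ʳ (List.map (0 ∷_) (compositions k (suc m)))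
  (∈-map⁺ suc-head (∈-compositions⁺ (suc k) m (h ∷ s) (ℕP.suc-injective Σs≡m)))

compositions-unique : ∀ k m → Unique (compositions k m)
compositions-unique zero    m       = [] ∷ []
compositions-unique (suc k) zero    = UniqueP.map⁺ VecP.∷-injectiveʳ (compositions-unique k zero)
compositions-unique (suc k) (suc m) = UniqueP.++⁺
  (UniqueP.map⁺ VecP.∷-injectiveʳ (compositions-unique k (suc m)))
  (UniqueP.map⁺ suc-head-injective (compositions-unique (suc k) m))
  disjoint
  where
  suc-head-injective : ∀ {k} {u v : Vec ℕ (suc k)} → suc-head u ≡ suc-head v → u ≡ v
  suc-head-injective {u = _ ∷ _} {_ ∷ _} refl = refl
  disjoint : Disjoint (List.map (0 ∷_) (compositions k (suc m))) (List.map suc-head (compositions (suc k) m))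
  disjoint (s∈₁ , s∈₂) with ∈-map⁻ (0 ∷_) s∈₁ | ∈-map⁻ suc-head s∈₂
  ... | _ , _ , refl | _ ∷ _ , _ , ()

length-compositions : ∀ k m → length (compositions k m) ≡ (m + k) C k
length-compositions zero    m       = refl
length-compositions (suc k) zero    = begin
  length (List.map (0 ∷_) (compositions k zero))   ≡⟨ ListP.length-map (0 ∷_) (compositions k zero) ⟩
  length (compositions k zero)                     ≡⟨ length-compositions k zero ⟩
  k C k                                            ≡⟨ nCn≡1 k ⟩
  1                                                ≡⟨ nCn≡1 (suc k) ⟨
  suc k C suc k                                    ∎
  where open ≡-Reasoning
length-compositions (suc k) (suc m) = begin
  length (List.map (0 ∷_) (compositions k (suc m)) ++ List.map suc-head (compositions (suc k) m))
    ≡⟨ ListP.length-++ (List.map (0 ∷_) (compositions k (suc m))) ⟩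
  length (List.map (0 ∷_) (compositions k (suc m))) + length (List.map suc-head (compositions (suc k) m))
    ≡⟨ cong₂ _+_ (ListP.length-map (0 ∷_) (compositions k (suc m))) (ListP.length-map suc-head (compositions (suc k) m)) ⟩
  length (compositions k (suc m)) + length (compositions (suc k) m)
    ≡⟨ cong₂ _+_ (length-compositions k (suc m)) (length-compositions (suc k) m) ⟩
  (suc m + k) C k + (m + suc k) C suc k
    ≡⟨ cong (λ j → (suc m + k) C k + j C suc k) (ℕP.+-suc m k) ⟩
  (suc m + k) C k + (suc m + k) C suc k
    ≡⟨ nCk+nC[k+1]≡[n+1]C[k+1] (suc m + k) k ⟩
  suc (suc m + k) C suc k
    ≡⟨ cong (λ j → suc j C suc k) (ℕP.+-suc m k) ⟨
  (suc m + suc k) C suc k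
    ∎
  where open ≡-Reasoning

HasCard-sum≡ : ∀ k m → HasCard (λ (s : Vec ℕ (suc k)) → sum s ≡ m) ((m + k) C k)
HasCard-sum≡ k m = compositions k m , compositions-unique k m ,
  (λ s → mk⇔ (∈-compositions⁻ k m) (∈-compositions⁺ k m s)) , length-compositions k m

shift : ∀ {k} → Vec ℤ k → Vec ℕ k → Vec ℤ k
shift w s = zipWith ℤ._+_ w (Vec.map +_ s)

shift-injective : ∀ {k} (w : Vec ℤ k) {s s′} → shift w s ≡ shift w s′ → s ≡ s′
shift-injective []      {[]}    {[]}      _  = refl
shift-injective (a ∷ w) {x ∷ s} {y ∷ s′} eq = cong₂ _∷_
  (ℤP.+-injective (ℤ+-cancelˡ-≡ a (VecP.∷-injectiveˡ eq)))
  (shift-injective w (VecP.∷-injectiveʳ eq))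

sumℤ-shift : ∀ {k} (w : Vec ℤ k) s → sumℤ (shift w s) ≡ sumℤ w ℤ.+ + sum s
sumℤ-shift w s = trans (sumℤ-zipWith w (Vec.map +_ s)) (cong (ℤ._+_ (sumℤ w)) (sumℤ-map-+ s))
  where
  sumℤ-map-+ : ∀ {k} (s : Vec ℕ k) → sumℤ (Vec.map +_ s) ≡ + sum s
  sumℤ-map-+ []      = refl
  sumℤ-map-+ (x ∷ s) = cong (ℤ._+_ (+ x)) (sumℤ-map-+ s)

≤⇔shift : ∀ {k} (w t : Vec ℤ k) → Pointwise ℤ._≤_ w t ⇔ ∃ λ s → t ≡ shift w s
≤⇔shift w t = mk⇔ (difference w t) (λ { (s , refl) → w≤shift w s })
  where
  i+[j-i]≡j : ∀ i j → i ℤ.+ (j ℤ.- i) ≡ j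
  i+[j-i]≡j = solve 2 (λ i j → i :+ (j :- i) := j) refl
    where open ℤSolver.+-*-Solver
  difference : ∀ {k} (w t : Vec ℤ k) → Pointwise ℤ._≤_ w t → ∃ λ s → t ≡ shift w s
  difference []      []      []          = [] , refl
  difference (a ∷ w) (c ∷ t) (a≤c ∷ w≤t) with difference w t w≤t
  ... | s , refl = ℤ.∣ a ℤ.- c ∣ ∷ s ,
    cong (_∷ shift w s) (trans (sym (i+[j-i]≡j a c)) (cong (ℤ._+_ a) (sym (ℤP.∣-∣-≤ a≤c))))
  w≤shift : ∀ {k} (w : Vec ℤ k) s → Pointwise ℤ._≤_ w (shift w s)
  w≤shift []      []      = []
  w≤shift (a ∷ w) (x ∷ s) = ℤP.i≤i+j a (+ x) ∷ w≤shift w s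

≤∧sumℤ⇔shift : ∀ {k} (w t : Vec ℤ k) m →
  (Pointwise ℤ._≤_ w t × sumℤ t ≡ sumℤ w ℤ.+ + m) ⇔ ∃ λ s → sum s ≡ m × t ≡ shift w s
≤∧sumℤ⇔shift w t m = mk⇔
  (λ { (w≤t , Σt≡Σw+m) → let s , t≡w+s = to (≤⇔shift w t) w≤t in
       s , ℤP.+-injective (ℤ+-cancelˡ-≡ (sumℤ w)
             (trans (sym (sumℤ-shift w s)) (trans (cong sumℤ (sym t≡w+s)) Σt≡Σw+m))) , t≡w+s })
  (λ { (s , refl , refl) → from (≤⇔shift w _) (s , refl) , sumℤ-shift w s })

embed-≤⇔ : ∀ {k} (u v : Vec ℤ k) → Pointwise ℚ._≤_ (embed u) (embed v) ⇔ Pointwise ℤ._≤_ u v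
embed-≤⇔ u v = mk⇔ (cancel u v) (Pointwise.map⁺ ℤtoℚ-mono-≤)
  where
  cancel : ∀ {k} (u v : Vec ℤ k) → Pointwise ℚ._≤_ (embed u) (embed v) → Pointwise ℤ._≤_ u v
  cancel []      []      []          = []
  cancel (a ∷ u) (c ∷ v) (a≤c ∷ u≤v) = ℤtoℚ-cancel-≤ a≤c ∷ cancel u v u≤v

embed-sum≡⇔ : ∀ {k} (w t : Vec ℤ k) m →
  sumℚ (embed t) ≡ sumℚ (embed w) ℚ.+ ℕtoℚ m ⇔ sumℤ t ≡ sumℤ w ℤ.+ + m
embed-sum≡⇔ w t m = mk⇔
  (λ eq → ℤtoℚ-injective (trans (sym (sumℚ-embed t)) (trans eq Σw+m≡)))
  (λ eq → trans (sumℚ-embed t) (trans (cong ℤtoℚ eq) (sym Σw+m≡)))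
  where
  Σw+m≡ : sumℚ (embed w) ℚ.+ ℕtoℚ m ≡ ℤtoℚ (sumℤ w ℤ.+ + m)
  Σw+m≡ = trans (cong (ℚ._+ ℕtoℚ m) (sumℚ-embed w)) (sym (ℤtoℚ-+ (sumℤ w) (+ m)))

lattice-translate-dilate-Δ⇔ : ∀ {d} (w t : Vec ℤ (suc d)) m →
  translate (embed w) (dilate (ℕtoℚ m) (Δ d)) (embed t) ⇔ ∃ λ s → sum s ≡ m × t ≡ shift w s
lattice-translate-dilate-Δ⇔ w t m =
  ≤∧sumℤ⇔shift w t m ⇔-∘
  ((embed-≤⇔ w t ×-⇔ embed-sum≡⇔ w t m) ⇔-∘ translate-dilate-Δ⇔ (embed w) m (embed t))

lemma3p1 : (d : ℕ) (b : Vec ℤ (suc d)) → InP d b → (n : ℕ) → 1 ≤ n →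
    (IsEmpty (dilate (ℕtoℚ n) (Δ d) ∩ minusVec (dilate (ℕtoℚ n) (Δ d)) b) ⇔ n < ℓ b)
    × (ℓ b ≤ n → SameSet (dilate (ℕtoℚ n) (Δ d) ∩ minusVec (dilate (ℕtoℚ n) (Δ d)) b)
                         (translate (embed (bminus b)) (dilate (ℕtoℚ (n ∸ ℓ b)) (Δ d))))
    × (ℓ b ≤ n → E-is d b n ((n ∸ ℓ b + d) C d))
    × (n < ℓ b → E-is d b n 0)
lemma3p1 d b (_ , Σb≡0) n _ = Δ-overlap-empty⇔ n Σb≡0 , Δ-overlap≃translate Σb≡0 , count , count-empty
  where
  count : ℓ b ≤ n → E-is d b n ((n ∸ ℓ b + d) C d)
  count ℓ≤n = HasCard-cong
    (λ t → ⇔-sym (Δ-overlap≃translate Σb≡0 ℓ≤n (embed t)) ⇔-∘ ⇔-sym (lattice-translate-dilate-Δ⇔ (bminus b) t (n ∸ ℓ b)))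
    (HasCard-image (shift-injective (bminus b)) (HasCard-sum≡ d (n ∸ ℓ b)))
  count-empty : n < ℓ b → E-is d b n 0
  count-empty n<ℓ = HasCard-none (λ t → from (Δ-overlap-empty⇔ n Σb≡0) n<ℓ (embed t))
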